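{- For an integer $k\ge 2$, let $L_{\mathrm{bal}}(k;2)$ be the largest positive integer $n$ for which there exists a coloring of $\{1,\ldots,n\}$ with two colors such that the two color classes have sizes differing by at most one and neither color class contains $k$ pairwise coprime integers. Then for every $k\ge2$, \[ L_{\mathrm{bal}}(k;2)=p_{2k-2}-1, \] where $p_m$ is the $m$-th prime ($p_1=2$).
   Context: A set of pairwise coprime integers means a set of distinct positive integers any two of which have greatest common divisor $1$. -}

module Defs where

open import Data.Nat using (ℕ; suc; _≤_; _+_)
open import Data.Nat.Primality using (Prime; prime?)
open import Data.Nat.Coprimality using (Coprime)
open import Data.Bool using (Bool; true; false)
import Data.Bool as B
open import Data.List using (List; length; filter; upTo; map)
open import Data.List.Relation.Unary.All using (All)
open import Data.List.Relation.Unary.AllPairs using (AllPairs)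
open import Data.Empty using (⊥)
open import Data.Product using (Σ; _×_; ∃)
open import Relation.Binary.PropositionalEquality using (_≡_; _≢_)

oneTo : ℕ → List ℕ
oneTo n = map suc (upTo n)

primeCount : ℕ → ℕ
primeCount n = length (filter prime? (upTo (suc n)))

IsNthPrime : ℕ → ℕ → Set
IsNthPrime m p = Prime p × primeCount p ≡ m

-- a 2-coloring of {1..n} is a map c : ℕ → Bool (only values on 1..n matter)
-- size of the color class of b within {1..n}
classSize : ℕ → (ℕ → Bool) → Bool → ℕ
classSize n c b = length (filter (λ i → c i B.≟ b) (oneTo n))

Balanced : ℕ → (ℕ → Bool) → Set
Balanced n c = classSize n c true ≤ classSize n c false + 1
             × classSize n c false ≤ classSize n c true + 1

HasCoprimeSet : ℕ → ℕ → (ℕ → Bool) → Bool → Set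
HasCoprimeSet k n c b =
  Σ (List ℕ) λ xs →
    length xs ≡ k
    × All (λ x → 1 ≤ x × x ≤ n × c x ≡ b) xs
    × AllPairs _≢_ xs
    × AllPairs Coprime xs

Good : ℕ → ℕ → Set
Good k n = ∃ λ (c : ℕ → Bool) →
  Balanced n c
  × (∀ b → HasCoprimeSet k n c b → ⊥)

IsLbal : ℕ → ℕ → Set
IsLbal k N = 1 ≤ N × Good k N × (∀ n → 1 ≤ n → Good k n → n ≤ N)

{-# OPTIONS --safe #-}
module Submission where

-- Upper bound: 1, p₁, …, p_{2k−2} are 2k − 1 pairwise coprime numbers in {1, …, p_{2k−2}}, so every
-- 2-colouring of {1, …, n} with n ≥ p_{2k−2} has k of them in one class.
--
-- Lower bound: let p = p_{2k−2} = 2h + 1. In a pairwise coprime set, label each element by itself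
-- (if it is 1) or by one of its prime factors; distinct elements get distinct labels. Colour a number
-- below p blue if it has a prime factor among p₁ = 2, p_k, …, p_{2k−3}, and red otherwise: red labels
-- lie in {1, p₂, …, p_{k−1}} and blue labels in {p₁, p_k, …, p_{2k−3}}, both of size k − 1. The
-- forced-red numbers are odd, so there are at most h of them. Blue numbers that are multiples of a
-- red prime can be recoloured red without breaking the labelling, and there are enough of them:
-- for k ≥ 5 the primes 3, 5, 7 are red, and 1 together with their multiples makes up at least half
-- of {1, …, 2h}. Recolouring them one at a time reaches exactly h red numbers.

open import Defs
open import Data.Bool using (Bool; true; false; not; if_then_else_; _∨_; T)
import Data.Bool as Bool
open import Data.Bool.Properties using (T-∨; T-≡)
open import Data.Empty using (⊥; ⊥-elim)
open import Data.List using (List; []; _∷_; [_]; _++_; _∷ʳ_; length; filter; map; upTo; take)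
open import Data.List.Membership.Propositional using (_∈_; find; lose)
open import Data.List.Membership.Propositional.Properties using (∈-filter⁻; ∈-upTo⁻; ∈-upTo⁺)
open import Data.List.Properties
  using (length-++; filter-++; map-++; upTo-∷ʳ; length-map; length-upTo; map-upTo; length-take;
         filter-all; filter-accept; filter-reject)
open import Data.List.Relation.Unary.All as All using (All; []; _∷_)
import Data.List.Relation.Unary.All.Properties as All
open import Data.List.Relation.Unary.AllPairs as AllPairs using (AllPairs; []; _∷_)
import Data.List.Relation.Unary.AllPairs.Properties as AllPairs
open import Data.List.Relation.Unary.Any using (Any; here; there; any?)
import Data.List.Relation.Unary.Unique.Propositional.Properties as Unique
open import Data.Nat
open import Data.Nat.Coprimality using (Coprime; 1-coprimeTo)
open import Data.Nat.Divisibility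
  using (_∣_; _∣?_; ∣-refl; ∣⇒≤; m∣m*n; divides; ∣m∣n⇒∣m+n; ∣m+n∣m⇒∣n; m%n≡0⇒n∣m)
open import Data.Nat.DivMod using (_/_; _%_; m≡m%n+[m/n]*n; m%n<n)
open import Data.Nat.Induction using (<-rec)
open import Data.Nat.ListAction using (product)
open import Data.Nat.ListAction.Properties using (∈⇒∣product)
open import Data.Nat.Primality
  using (Prime; prime?; prime⇒nonTrivial; ¬prime[1]; prime[2]; prime⇒irreducible)
open import Data.Nat.Primality.Factorisation
  using (PrimeFactorisation; factorise; factorisationHasAllPrimeFactors)
open import Data.Nat.Properties
open import Data.Nat.Tactic.RingSolver using (solve-∀)
open import Data.Product using (Σ; ∃-syntax; _×_; _,_; proj₁; proj₂; uncurry)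
open import Data.Sum using (_⊎_; inj₁; inj₂; [_,_]′)
open import Data.Unit using (tt)
open import Function using (_∘_; _⇔_; mk⇔; Equivalence)
open import Level using (0ℓ)
open import Relation.Binary.Core using (Rel)
open import Relation.Binary.Definitions using (tri<; tri≈; tri>)
open import Relation.Binary.PropositionalEquality hiding ([_])
open import Relation.Nullary using (¬_; yes; no; does; ¬?; contradiction)
open import Relation.Nullary.Decidable using (_⊎-dec_; dec-true; dec-false; does-⇔; from-yes)
open import Relation.Unary using (Pred; Decidable)

-- Counting on {1, …, n}

Within : ℕ → (ℕ → Set) → Set
Within n P = ∀ {x} → 1 ≤ x → x ≤ n → P x

within-init : ∀ {n P} → Within (suc n) P → Within n P
within-init P[1‥n+1] 1≤x x≤n = P[1‥n+1] 1≤x (m≤n⇒m≤1+n x≤n)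

within-last : ∀ {n P} → Within (suc n) P → P (suc n)
within-last P[1‥n+1] = P[1‥n+1] (s≤s z≤n) ≤-refl

_⊆[_]_ : (ℕ → Bool) → ℕ → (ℕ → Bool) → Set
f ⊆[ n ] g = Within n (λ x → T (f x) → T (g x))

count : (ℕ → Bool) → ℕ → ℕ
count f zero    = 0
count f (suc n) = if f (suc n) then suc (count f n) else count f n

count-cong : ∀ {f g} n → Within n (λ x → f x ≡ g x) → count f n ≡ count g n
count-cong zero    _   = refl
count-cong (suc n) f≗g =
  cong₂ (λ b m → if b then suc m else m) (within-last f≗g) (count-cong n (within-init f≗g))

count-mono : ∀ {f g} n → f ⊆[ n ] g → count f n ≤ count g n
count-mono zero _ = z≤n
count-mono {f} {g} (suc n) f⊆g
  with count-mono n (within-init f⊆g) | f (suc n) | g (suc n) | within-last f⊆g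
... | ih | true  | true  | _   = s≤s ih
... | ih | true  | false | f⇒g = ⊥-elim (f⇒g _)
... | ih | false | true  | _   = m≤n⇒m≤1+n ih
... | ih | false | false | _   = ih

count[1+n]≤1+count[n] : ∀ f n → count f (suc n) ≤ suc (count f n)
count[1+n]≤1+count[n] f n with f (suc n)
... | true  = ≤-refl
... | false = n≤1+n _

count[n]≤count[1+n] : ∀ f n → count f n ≤ count f (suc n)
count[n]≤count[1+n] f n with f (suc n)
... | true  = n≤1+n _
... | false = ≤-refl

count-monoʳ : ∀ f {m n} → m ≤ n → count f m ≤ count f n
count-monoʳ f {n = zero}  z≤n = ≤-refl
count-monoʳ f {n = suc n} m≤1+n with m≤n⇒m<n∨m≡n m≤1+n
... | inj₁ (s≤s m≤n) = ≤-trans (count-monoʳ f m≤n) (count[n]≤count[1+n] f n)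
... | inj₂ refl      = ≤-refl

count-agreeExcept : ∀ {f g} y n → (∀ {x} → x ≢ y → g x ≡ f x) → count g n ≤ suc (count f n)
count-agreeExcept y zero _ = z≤n
count-agreeExcept {f} {g} y (suc n) g≗f with suc n ≟ y
... | yes refl = begin
  count g (suc n)        ≤⟨ count[1+n]≤1+count[n] g n ⟩
  suc (count g n)        ≡⟨ cong suc (count-cong n (λ _ x≤n → g≗f (<⇒≢ (s≤s x≤n)))) ⟩
  suc (count f n)        ≤⟨ s≤s (count[n]≤count[1+n] f n) ⟩
  suc (count f (suc n))  ∎
  where open ≤-Reasoning
... | no n+1≢y rewrite g≗f n+1≢y with count-agreeExcept y n g≗f | f (suc n)
...   | ih | true  = s≤s ih
...   | ih | false = ih

count-periodic : ∀ {f} P → (∀ x → f (x + P) ≡ f x) → ∀ n → count f (n + P) ≡ count f n + count f P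
count-periodic P f-periodic zero = refl
count-periodic {f} P f-periodic (suc n)
  rewrite f-periodic (suc n) | count-periodic P f-periodic n with f (suc n)
... | true  = refl
... | false = refl

evensFalse⇒count[2h]≤h : ∀ {f} h → (∀ i → f (2 + (i + i)) ≡ false) → count f (h + h) ≤ h
evensFalse⇒count[2h]≤h zero _ = z≤n
evensFalse⇒count[2h]≤h {f} (suc h) f[2+2i]≡false rewrite +-suc h h | f[2+2i]≡false h =
  ≤-trans (count[1+n]≤1+count[n] f (h + h)) (s≤s (evensFalse⇒count[2h]≤h h f[2+2i]≡false))

intermediate-value : (φ : ℕ → ℕ) → (∀ m → φ (suc m) ≤ suc (φ m)) →
                     ∀ n {t} → φ 0 ≤ t → t ≤ φ n → ∃[ m ] φ m ≡ t
intermediate-value φ φ-step zero    φ0≤t t≤φ0 = 0 , ≤-antisym φ0≤t t≤φ0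
intermediate-value φ φ-step (suc n) {t} φ0≤t t≤φn+1 with t ≤? φ n
... | yes t≤φn = intermediate-value φ φ-step n φ0≤t t≤φn
... | no  t≰φn = suc n , ≤-antisym (≤-trans (φ-step n) (≰⇒> t≰φn)) t≤φn+1

splice : (ℕ → Bool) → (ℕ → Bool) → ℕ → ℕ → Bool
splice g f m x = if x ≤ᵇ m then g x else f x

splice-agreeExcept : ∀ g f m {x} → x ≢ suc m → splice g f (suc m) x ≡ splice g f m x
splice-agreeExcept g f m {x} x≢1+m with x ≤? m
... | yes x≤m rewrite dec-true (x ≤? suc m) (m≤n⇒m≤1+n x≤m) | dec-true (x ≤? m) x≤m = refl
... | no  x≰m
  rewrite dec-false (x ≤? suc m) (λ x≤1+m → [ x≰m ∘ ≤-pred , x≢1+m ]′ (m≤n⇒m<n∨m≡n x≤1+m))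
        | dec-false (x ≤? m) x≰m = refl

splice-start : ∀ g f n → Within n (λ x → splice g f 0 x ≡ f x)
splice-start g f n (s≤s _) _ = refl

splice-end : ∀ g f n → Within n (λ x → splice g f n x ≡ g x)
splice-end g f n {x} _ x≤n rewrite dec-true (x ≤? n) x≤n = refl

⊆-splice : ∀ {f g n} m → f ⊆[ n ] g → f ⊆[ n ] splice g f m
⊆-splice m f⊆g {x} 1≤x x≤n with x ≤ᵇ m
... | true  = f⊆g 1≤x x≤n
... | false = λ fx → fx

splice-⊆ : ∀ {f g n} m → f ⊆[ n ] g → splice g f m ⊆[ n ] g
splice-⊆ m f⊆g {x} 1≤x x≤n with x ≤ᵇ m
... | true  = λ gx → gx
... | false = f⊆g 1≤x x≤n

intermediate-colouring : ∀ {f g} n {t} → f ⊆[ n ] g → count f n ≤ t → t ≤ count g n →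
                         ∃[ c ] f ⊆[ n ] c × c ⊆[ n ] g × count c n ≡ t
intermediate-colouring {f} {g} n {t} f⊆g f≤t t≤g =
  colouring (intermediate-value φ φ-step n
    (subst (_≤ t) (count-cong n (λ 1≤x x≤n → sym (splice-start g f n 1≤x x≤n))) f≤t)
    (subst (t ≤_) (count-cong n (λ 1≤x x≤n → sym (splice-end g f n 1≤x x≤n))) t≤g))
  where
  φ : ℕ → ℕ
  φ m = count (splice g f m) n
  φ-step : ∀ m → φ (suc m) ≤ suc (φ m)
  φ-step m = count-agreeExcept (suc m) n (splice-agreeExcept g f m)
  colouring : ∃[ m ] φ m ≡ t → ∃[ c ] f ⊆[ n ] c × c ⊆[ n ] g × count c n ≡ t
  colouring (m , φm≡t) = splice g f m , ⊆-splice m f⊆g , splice-⊆ m f⊆g , φm≡t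

oneTo-∷ʳ : ∀ n → oneTo (suc n) ≡ oneTo n ∷ʳ suc n
oneTo-∷ʳ n = trans (cong (map suc) (sym (upTo-∷ʳ n))) (map-++ suc (upTo n) [ n ])

length-filter-oneTo : ∀ {P : ℕ → Set} (P? : Decidable P) n →
                      length (filter P? (oneTo n)) ≡ count (does ∘ P?) n
length-filter-oneTo P? zero    = refl
length-filter-oneTo P? (suc n) = begin
  length (filter P? (oneTo (suc n)))
    ≡⟨ cong (length ∘ filter P?) (oneTo-∷ʳ n) ⟩
  length (filter P? (oneTo n ++ [ suc n ]))
    ≡⟨ cong length (filter-++ P? (oneTo n) [ suc n ]) ⟩
  length (filter P? (oneTo n) ++ filter P? [ suc n ])
    ≡⟨ length-++ (filter P? (oneTo n)) ⟩
  length (filter P? (oneTo n)) + length (filter P? [ suc n ])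
    ≡⟨ cong (_+ length (filter P? [ suc n ])) (length-filter-oneTo P? n) ⟩
  count (does ∘ P?) n + length (filter P? [ suc n ])
    ≡⟨ add-last ⟩
  count (does ∘ P?) (suc n)
    ∎
  where
  open ≡-Reasoning
  add-last : count (does ∘ P?) n + length (filter P? [ suc n ]) ≡ count (does ∘ P?) (suc n)
  add-last with does (P? (suc n))
  ... | true  = +-comm _ 1
  ... | false = +-identityʳ _

classSize-true≡count : ∀ n c → classSize n c true ≡ count c n
classSize-true≡count n c =
  trans (length-filter-oneTo (λ x → c x Bool.≟ true) n) (count-cong n (λ {x} _ _ → does-≟true (c x)))
  where
  does-≟true : ∀ b → does (b Bool.≟ true) ≡ b
  does-≟true true  = refl
  does-≟true false = refl

colourClasses-length : ∀ (c : ℕ → Bool) xs →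
  length (filter (λ x → c x Bool.≟ true) xs) + length (filter (λ x → c x Bool.≟ false) xs) ≡ length xs
colourClasses-length c []       = refl
colourClasses-length c (x ∷ xs) with c x
... | true  = cong suc (colourClasses-length c xs)
... | false = trans (+-suc _ _) (cong suc (colourClasses-length c xs))

classSize-true+false≡n : ∀ n c → classSize n c true + classSize n c false ≡ n
classSize-true+false≡n n c =
  trans (colourClasses-length c (oneTo n)) (trans (length-map suc (upTo n)) (length-upTo n))

count≡half⇒balanced : ∀ h c → count c (h + h) ≡ h → Balanced (h + h) c
count≡half⇒balanced h c count≡h = ≤-trans (≤-reflexive (trans true≡h (sym false≡h))) (m≤m+n _ 1)
                                , ≤-trans (≤-reflexive (trans false≡h (sym true≡h))) (m≤m+n _ 1)
  where
  true≡h : classSize (h + h) c true ≡ h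
  true≡h = trans (classSize-true≡count (h + h) c) count≡h
  false≡h : classSize (h + h) c false ≡ h
  false≡h = +-cancelˡ-≡ h _ _ (trans (cong (_+ classSize (h + h) c false) (sym true≡h))
                                     (classSize-true+false≡n (h + h) c))

isPrime : ℕ → Bool
isPrime n = does (prime? n)

-- primeCount also inspects 0, which is not prime.
primeCount≡count : ∀ n → primeCount n ≡ count isPrime n
primeCount≡count n =
  trans (cong (length ∘ filter prime?) (sym (map-upTo suc n))) (length-filter-oneTo prime? n)

prime⇒≥2 : ∀ {p} → Prime p → 2 ≤ p
prime⇒≥2 {p} p-prime = nonTrivial⇒n>1 p {{prime⇒nonTrivial p-prime}}

primeCount-mono : ∀ {m n} → m ≤ n → primeCount m ≤ primeCount n
primeCount-mono {m} {n} m≤n rewrite primeCount≡count m | primeCount≡count n = count-monoʳ isPrime m≤n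

primeCount-suc-prime : ∀ n → Prime (suc n) → primeCount (suc n) ≡ suc (primeCount n)
primeCount-suc-prime n n+1-prime
  rewrite primeCount≡count (suc n) | primeCount≡count n | dec-true (prime? (suc n)) n+1-prime = refl

primeCount-<-prime : ∀ {m q} → Prime q → m < q → primeCount m < primeCount q
primeCount-<-prime {m} {suc q} q+1-prime (s≤s m≤q) =
  subst (primeCount m <_) (sym (primeCount-suc-prime q q+1-prime)) (s≤s (primeCount-mono m≤q))

primeCount-injective : ∀ {p q} → Prime p → Prime q → primeCount p ≡ primeCount q → p ≡ q
primeCount-injective {p} {q} p-prime q-prime π[p]≡π[q] with <-cmp p q
... | tri< p<q _ _ = contradiction π[p]≡π[q] (<⇒≢ (primeCount-<-prime q-prime p<q))
... | tri≈ _ p≡q _ = p≡q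
... | tri> _ _ q<p = contradiction (sym π[p]≡π[q]) (<⇒≢ (primeCount-<-prime p-prime q<p))

primeCount-positive : ∀ {p} → Prime p → 1 ≤ primeCount p
primeCount-positive p-prime = primeCount-mono (prime⇒≥2 p-prime)

-- Pairwise coprime sets

module _ {A B : Set} {P : Pred A 0ℓ} (f : ∀ {x} → P x → B) where

  length-reduce : ∀ {xs} (pxs : All P xs) → length (All.reduce f pxs) ≡ length xs
  length-reduce []        = refl
  length-reduce (_ ∷ pxs) = cong suc (length-reduce pxs)

  all-reduce : ∀ {Q : Pred B 0ℓ} → (∀ {x} (px : P x) → Q (f px)) →
               ∀ {xs} (pxs : All P xs) → All Q (All.reduce f pxs)
  all-reduce Q-f []         = []
  all-reduce Q-f (px ∷ pxs) = Q-f px ∷ all-reduce Q-f pxs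

  allPairs-reduce : ∀ {R : Rel A 0ℓ} {S : Rel B 0ℓ} →
                    (∀ {x y} (px : P x) (py : P y) → R x y → S (f px) (f py)) →
                    ∀ {xs} (pxs : All P xs) → AllPairs R xs → AllPairs S (All.reduce f pxs)
  allPairs-reduce S-f []         []         = []
  allPairs-reduce {R} {S} S-f (px ∷ pxs) (Rx ∷ Rxs) = related pxs Rx ∷ allPairs-reduce S-f pxs Rxs
    where
    related : ∀ {ys} (pys : All P ys) → All (R _) ys → All (S (f px)) (All.reduce f pys)
    related []         []           = []
    related (py ∷ pys) (Rxy ∷ Rxys) = S-f px py Rxy ∷ related pys Rxys

allPairs-combine : ∀ {A : Set} {P : Pred A 0ℓ} {R S : Rel A 0ℓ} → (∀ {x y} → P x → P y → R x y → S x y) →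
                   ∀ {xs} → All P xs → AllPairs R xs → AllPairs S xs
allPairs-combine             combine []         []         = []
allPairs-combine {P = P} {R} {S} combine (px ∷ pxs) (Rx ∷ Rxs) =
  related pxs Rx ∷ allPairs-combine combine pxs Rxs
  where
  related : ∀ {ys} → All P ys → All (R _) ys → All (S _) ys
  related []         []           = []
  related (py ∷ pys) (Rxy ∷ Rxys) = combine px py Rxy ∷ related pys Rxys

length≤1+length-filter-≢ : ∀ v {ys} → AllPairs _≢_ ys →
                           length ys ≤ suc (length (filter (λ y → ¬? (y ≟ v)) ys))
length≤1+length-filter-≢ v []                   = z≤n
length≤1+length-filter-≢ v {y ∷ ys} (y∉ys ∷ ys!) with y ≟ v
... | yes refl = s≤s (≤-reflexive (sym (cong length (begin
  filter ≢y? (y ∷ ys)  ≡⟨ filter-reject ≢y? (λ y≢y → y≢y refl) ⟩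
  filter ≢y? ys        ≡⟨ filter-all ≢y? (All.map (λ y≢z z≡y → y≢z (sym z≡y)) y∉ys) ⟩
  ys                   ∎))))
  where
  open ≡-Reasoning
  ≢y? : Decidable (λ z → ¬ z ≡ y)
  ≢y? z = ¬? (z ≟ y)
... | no  y≢v  = subst (λ zs → suc (length ys) ≤ suc (length zs))
                   (sym (filter-accept (λ z → ¬? (z ≟ v)) y≢v)) (s≤s (length≤1+length-filter-≢ v ys!))

distinct-below⇒length≤ : ∀ m {ys} → AllPairs _≢_ ys → All (_< m) ys → length ys ≤ m
distinct-below⇒length≤ zero    []  []       = z≤n
distinct-below⇒length≤ zero    _   (() ∷ _)
distinct-below⇒length≤ (suc m) {ys} ys! ys<1+m = begin
  length ys                     ≤⟨ length≤1+length-filter-≢ m ys! ⟩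
  suc (length (filter ≢m? ys))  ≤⟨ s≤s (distinct-below⇒length≤ m (AllPairs.filter⁺ ≢m? ys!) rest<m) ⟩
  suc m                         ∎
  where
  open ≤-Reasoning
  ≢m? : Decidable (λ y → ¬ y ≡ m)
  ≢m? y = ¬? (y ≟ m)
  rest<m : All (_< m) (filter ≢m? ys)
  rest<m = All.zipWith (λ (y<1+m , y≢m) → ≤∧≢⇒< (≤-pred y<1+m) y≢m)
                       (All.filter⁺ ≢m? ys<1+m , All.all-filter ≢m? ys)

Witness : ℕ → ℕ → Set
Witness d x = d ≡ x ⊎ (Prime d × d ∣ x)

witness⇒∣ : ∀ {d x} → Witness d x → d ∣ x
witness⇒∣ (inj₁ refl)      = ∣-refl
witness⇒∣ (inj₂ (_ , d∣x)) = d∣x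

shared-witness⇒≡ : ∀ {d x y} → Witness d x → Witness d y → Coprime x y → x ≡ y
shared-witness⇒≡ d-x d-y x⊥y with x⊥y (witness⇒∣ d-x , witness⇒∣ d-y)
shared-witness⇒≡ (inj₁ refl)           (inj₁ refl)           _ | _    = refl
shared-witness⇒≡ (inj₂ (d-prime , _)) _                     _ | refl = contradiction d-prime ¬prime[1]
shared-witness⇒≡ (inj₁ _)              (inj₂ (d-prime , _)) _ | refl = contradiction d-prime ¬prime[1]

PrimeOfRankIn : ℕ → ℕ → ℕ → Set
PrimeOfRankIn lo m q = Prime q × lo < primeCount q × primeCount q ≤ lo + m

-- The m + 1 admissible witnesses are s and the primes p_{lo+1}, …, p_{lo+m}.
WitnessedIn : ℕ → ℕ → ℕ → ℕ → Set
WitnessedIn s lo m x = ∃[ d ] Witness d x × (d ≡ s ⊎ PrimeOfRankIn lo m d)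

module _ {s lo m : ℕ} where

  windowLabel : ∀ {x} → WitnessedIn s lo m x → ℕ
  windowLabel (_ , _ , inj₁ _) = 0
  windowLabel (d , _ , inj₂ _) = primeCount d ∸ lo

  windowLabel-< : ∀ {x} (w : WitnessedIn s lo m x) → windowLabel w < suc m
  windowLabel-< (_ , _ , inj₁ _)                = s≤s z≤n
  windowLabel-< (d , _ , inj₂ (_ , _ , π≤lo+m)) =
    s≤s (subst (primeCount d ∸ lo ≤_) (m+n∸m≡n lo m) (∸-monoˡ-≤ lo π≤lo+m))

  windowLabel-injective : ∀ {x y} (w : WitnessedIn s lo m x) (w′ : WitnessedIn s lo m y) →
                          windowLabel w ≡ windowLabel w′ → proj₁ w ≡ proj₁ w′
  windowLabel-injective (_ , _ , inj₁ d≡s) (_ , _ , inj₁ d′≡s) _ = trans d≡s (sym d′≡s)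
  windowLabel-injective (_ , _ , inj₁ _) (_ , _ , inj₂ (_ , lo<π , _)) 0≡ℓ =
    contradiction 0≡ℓ (<⇒≢ (m<n⇒0<n∸m lo<π))
  windowLabel-injective (_ , _ , inj₂ (_ , lo<π , _)) (_ , _ , inj₁ _) ℓ≡0 =
    contradiction (sym ℓ≡0) (<⇒≢ (m<n⇒0<n∸m lo<π))
  windowLabel-injective (_ , _ , inj₂ (d-prime , lo<π , _)) (_ , _ , inj₂ (d′-prime , lo<π′ , _)) ℓ≡ℓ′ =
    primeCount-injective d-prime d′-prime (∸-cancelʳ-≡ (<⇒≤ lo<π) (<⇒≤ lo<π′) ℓ≡ℓ′)

  windowLabel-separates : ∀ {x y} (w : WitnessedIn s lo m x) (w′ : WitnessedIn s lo m y) →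
                          x ≢ y × Coprime x y → windowLabel w ≢ windowLabel w′
  windowLabel-separates w@(_ , d-x , _) w′@(_ , d-y , _) (x≢y , x⊥y) ℓ≡ℓ′
    with refl ← windowLabel-injective w w′ ℓ≡ℓ′ = x≢y (shared-witness⇒≡ d-x d-y x⊥y)

  window-pigeonhole : ∀ {xs} → AllPairs _≢_ xs → AllPairs Coprime xs → All (WitnessedIn s lo m) xs →
                      length xs ≤ suc m
  window-pigeonhole {xs} xs! xs-coprime ws = begin
    length xs                          ≡⟨ length-reduce windowLabel ws ⟨
    length (All.reduce windowLabel ws) ≤⟨ distinct-below⇒length≤ (suc m) labels! labels<1+m ⟩
    suc m                              ∎
    where
    open ≤-Reasoning
    labels! : AllPairs _≢_ (All.reduce windowLabel ws)
    labels! = allPairs-reduce windowLabel windowLabel-separates ws (AllPairs.zip (xs! , xs-coprime))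
    labels<1+m : All (_< suc m) (All.reduce windowLabel ws)
    labels<1+m = all-reduce windowLabel windowLabel-< ws

-- The upper bound

distinct-primes-coprime : ∀ {p q} → Prime p → Prime q → p ≢ q → Coprime p q
distinct-primes-coprime p-prime q-prime p≢q (d∣p , d∣q) with prime⇒irreducible p-prime d∣p
... | inj₁ d≡1 = d≡1
... | inj₂ refl with prime⇒irreducible q-prime d∣q
...   | inj₁ refl = contradiction p-prime ¬prime[1]
...   | inj₂ p≡q  = contradiction p≡q p≢q

primesUpTo : ℕ → List ℕ
primesUpTo n = filter prime? (upTo (suc n))

∈-primesUpTo⁻ : ∀ {n q} → q ∈ primesUpTo n → q ≤ n × Prime q
∈-primesUpTo⁻ q∈ with q∈upTo , q-prime ← ∈-filter⁻ prime? q∈ = ≤-pred (∈-upTo⁻ q∈upTo) , q-prime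

primesUpTo-prime : ∀ n → All Prime (primesUpTo n)
primesUpTo-prime n = All.tabulate (proj₂ ∘ ∈-primesUpTo⁻ {n})

primesUpTo-distinct : ∀ n → AllPairs _≢_ (primesUpTo n)
primesUpTo-distinct n = Unique.filter⁺ prime? (Unique.upTo⁺ (suc n))

oneAndPrimesUpTo : ℕ → List ℕ
oneAndPrimesUpTo n = 1 ∷ primesUpTo n

oneAndPrimesUpTo-range : ∀ {p n} → 1 ≤ p → p ≤ n → All (λ x → 1 ≤ x × x ≤ n) (oneAndPrimesUpTo p)
oneAndPrimesUpTo-range 1≤p p≤n = (≤-refl , ≤-trans 1≤p p≤n)
  ∷ All.tabulate (λ q∈ → let q≤p , q-prime = ∈-primesUpTo⁻ q∈
                         in ≤-trans (s≤s z≤n) (prime⇒≥2 q-prime) , ≤-trans q≤p p≤n)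

oneAndPrimesUpTo-distinct : ∀ p → AllPairs _≢_ (oneAndPrimesUpTo p)
oneAndPrimesUpTo-distinct p =
  All.map (λ q-prime 1≡q → ¬prime[1] (subst Prime (sym 1≡q) q-prime)) (primesUpTo-prime p)
  ∷ primesUpTo-distinct p

oneAndPrimesUpTo-coprime : ∀ p → AllPairs Coprime (oneAndPrimesUpTo p)
oneAndPrimesUpTo-coprime p = All.universal 1-coprimeTo _
  ∷ allPairs-combine distinct-primes-coprime (primesUpTo-prime p) (primesUpTo-distinct p)

colourClass-coprimeSet : ∀ {k n} (c : ℕ → Bool) b {xs} → All (λ x → 1 ≤ x × x ≤ n) xs →
                         AllPairs _≢_ xs → AllPairs Coprime xs →
                         k ≤ length (filter (λ x → c x Bool.≟ b) xs) → HasCoprimeSet k n c b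
colourClass-coprimeSet {k} c b {xs} xs-range xs! xs-coprime k≤|class| =
    take k class
  , trans (length-take k class) (m≤n⇒m⊓n≡m k≤|class|)
  , All.take⁺ k (All.zipWith (λ ((1≤x , x≤n) , cx≡b) → 1≤x , x≤n , cx≡b)
                             (All.filter⁺ coloured? xs-range , All.all-filter coloured? xs))
  , AllPairs.take⁺ k (AllPairs.filter⁺ coloured? xs!)
  , AllPairs.take⁺ k (AllPairs.filter⁺ coloured? xs-coprime)
  where
  coloured? : Decidable (λ x → c x ≡ b)
  coloured? x = c x Bool.≟ b
  class : List ℕ
  class = filter coloured? xs

k≤a⊎k≤b : ∀ {k a b} → k + k ≤ suc (a + b) → k ≤ a ⊎ k ≤ b
k≤a⊎k≤b {k} {a} {b} 2k≤1+a+b with k ≤? a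
... | yes k≤a = inj₁ k≤a
... | no  k≰a = inj₂ (+-cancelˡ-≤ k k b (≤-trans 2k≤1+a+b (+-monoˡ-≤ b (≰⇒> k≰a))))

monochromatic-coprimeSet : ∀ {k n} (c : ℕ → Bool) {xs} → All (λ x → 1 ≤ x × x ≤ n) xs →
                           AllPairs _≢_ xs → AllPairs Coprime xs → k + k ≤ suc (length xs) →
                           Σ Bool (HasCoprimeSet k n c)
monochromatic-coprimeSet {k} c {xs} xs-range xs! xs-coprime 2k≤1+|xs|
  with k≤a⊎k≤b (subst (λ l → k + k ≤ suc l) (sym (colourClasses-length c xs)) 2k≤1+|xs|)
... | inj₁ k≤|true|  = true  , colourClass-coprimeSet c true  xs-range xs! xs-coprime k≤|true|
... | inj₂ k≤|false| = false , colourClass-coprimeSet c false xs-range xs! xs-coprime k≤|false|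

monochromatic-coprimeSet-≥p : ∀ {k p n} → Prime p → k + k ≤ 2 + primeCount p → p ≤ n →
                              (c : ℕ → Bool) → Σ Bool (HasCoprimeSet k n c)
monochromatic-coprimeSet-≥p {p = p} p-prime 2k≤2+π[p] p≤n c =
  monochromatic-coprimeSet c (oneAndPrimesUpTo-range (≤-trans (s≤s z≤n) (prime⇒≥2 p-prime)) p≤n)
    (oneAndPrimesUpTo-distinct p) (oneAndPrimesUpTo-coprime p) 2k≤2+π[p]

-- The balanced colouring

-- Junk value: 0 gets the empty list; only positive arguments are ever used.
primeFactors : ℕ → List ℕ
primeFactors zero    = []
primeFactors (suc n) = PrimeFactorisation.factors (factorise (suc n))

primeFactors-prime : ∀ n → All Prime (primeFactors n)
primeFactors-prime zero    = []
primeFactors-prime (suc n) = PrimeFactorisation.factorsPrime (factorise (suc n))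

primeFactors-product : ∀ n → suc n ≡ product (primeFactors (suc n))
primeFactors-product n = PrimeFactorisation.isFactorisation (factorise (suc n))

-- For k = j + 2 the blue primes are p₁ = 2 and p_k, p_{k+1}, …; the red ones are p₂, …, p_{k−1}.
BlueRank : ℕ → ℕ → Set
BlueRank j r = r ≡ 1 ⊎ 2 + j ≤ r

blueRank? : ∀ j → Decidable (BlueRank j)
blueRank? j r = (r ≟ 1) ⊎-dec (2 + j ≤? r)

HasBlueFactor : ℕ → ℕ → Set
HasBlueFactor j x = Any (BlueRank j ∘ primeCount) (primeFactors x)

forcedRed : ℕ → ℕ → Bool
forcedRed j x = not (does (any? (blueRank? j ∘ primeCount) (primeFactors x)))

forcedRed⇒¬blueFactor : ∀ j x → T (forcedRed j x) → ¬ HasBlueFactor j x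
forcedRed⇒¬blueFactor j x F with any? (blueRank? j ∘ primeCount) (primeFactors x)
... | yes _    = ⊥-elim F
... | no ¬blue = ¬blue

¬forcedRed⇒blueFactor : ∀ j x → ¬ T (forcedRed j x) → HasBlueFactor j x
¬forcedRed⇒blueFactor j x ¬F with any? (blueRank? j ∘ primeCount) (primeFactors x)
... | yes blue = blue
... | no  _    = contradiction _ ¬F

forcedRed-even : ∀ j i → forcedRed j (2 + (i + i)) ≡ false
forcedRed-even j i = cong not (dec-true (any? (blueRank? j ∘ primeCount) (primeFactors x))
  (lose (factorisationHasAllPrimeFactors prime[2] (subst (2 ∣_) (primeFactors-product (suc (i + i))) 2∣x)
                                         (primeFactors-prime x))
        (inj₁ refl)))
  where
  x = 2 + (i + i)
  2∣x : 2 ∣ x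
  2∣x = divides (suc i) (cong (2 +_) (trans (cong (i +_) (sym (+-identityʳ i))) (*-comm 2 i)))

noBlueFactor⇒witnessed : ∀ j {x} fs → x ≡ product fs → All Prime fs →
                         ¬ Any (BlueRank j ∘ primeCount) fs → WitnessedIn 1 1 j x
noBlueFactor⇒witnessed j []       refl []            _     = 1 , inj₁ refl , inj₁ refl
noBlueFactor⇒witnessed j (q ∷ fs) refl (q-prime ∷ _) ¬blue =
  q , inj₂ (q-prime , m∣m*n (product fs)) , inj₂ (q-prime , 1<π[q] , π[q]≤1+j)
  where
  1<π[q] : 1 < primeCount q
  1<π[q] = ≤∧≢⇒< (primeCount-positive q-prime) (λ 1≡π[q] → ¬blue (here (inj₁ (sym 1≡π[q]))))
  π[q]≤1+j : primeCount q ≤ 1 + j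
  π[q]≤1+j = ≤-pred (≰⇒> (λ 2+j≤π[q] → ¬blue (here (inj₂ 2+j≤π[q]))))

forcedRed⇒witnessed : ∀ j {x} → 1 ≤ x → T (forcedRed j x) → WitnessedIn 1 1 j x
forcedRed⇒witnessed j {suc n} _ F =
  noBlueFactor⇒witnessed j (primeFactors (suc n)) (primeFactors-product n) (primeFactors-prime (suc n))
                         (forcedRed⇒¬blueFactor j (suc n) F)

blueFactor⇒witnessed : ∀ j {p x} → Prime p → primeCount p ≡ 2 + (j + j) → 1 ≤ x → x < p →
                       HasBlueFactor j x → WitnessedIn 2 (suc j) j x
blueFactor⇒witnessed j {p} {suc n} p-prime π[p] _ x<p blue
  with q , q∈fs , q-blue ← find blue = q , inj₂ (q-prime , q∣x) , window q-blue
  where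
  q-prime : Prime q
  q-prime = All.lookup (primeFactors-prime (suc n)) q∈fs
  q∣x : q ∣ suc n
  q∣x = subst (q ∣_) (sym (primeFactors-product n)) (∈⇒∣product q∈fs)
  π[q]≤1+2j : primeCount q ≤ suc j + j
  π[q]≤1+2j = ≤-pred (subst (primeCount q <_) π[p] (primeCount-<-prime p-prime (≤-<-trans (∣⇒≤ q∣x) x<p)))
  window : BlueRank j (primeCount q) → q ≡ 2 ⊎ PrimeOfRankIn (suc j) j q
  window (inj₁ π[q]≡1)   = inj₁ (primeCount-injective q-prime prime[2] π[q]≡1)
  window (inj₂ 2+j≤π[q]) = inj₂ (q-prime , 2+j≤π[q] , π[q]≤1+2j)

multipleOfAny : List ℕ → ℕ → Bool
multipleOfAny qs x = does (any? (_∣? x) qs)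

padding : List ℕ → ℕ → Bool
padding qs x = (x ≡ᵇ 1) ∨ multipleOfAny qs x

padding⇒witnessed : ∀ j {qs x} → All (PrimeOfRankIn 1 j) qs → T (padding qs x) → WitnessedIn 1 1 j x
padding⇒witnessed j {qs} {x} qs-red pad with x ≡ᵇ 1 in x≡ᵇ1 | any? (_∣? x) qs
... | true  | _             = 1 , inj₁ (sym (≡ᵇ⇒≡ x 1 (Equivalence.from T-≡ x≡ᵇ1))) , inj₁ refl
... | false | no  _         = ⊥-elim pad
... | false | yes divisible with q , q∈qs , q∣x ← find divisible =
  q , inj₂ (proj₁ (All.lookup qs-red q∈qs) , q∣x) , inj₂ (All.lookup qs-red q∈qs)

good-colouring : ∀ j {p h qs} → Prime p → primeCount p ≡ 2 + (j + j) → p ≡ suc (h + h) →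
                 All (PrimeOfRankIn 1 j) qs → h ≤ count (padding qs) (h + h) → Good (2 + j) (h + h)
good-colouring j {p} {h} {qs} p-prime π[p] p≡1+2h qs-red h≤|padding| =
  good (intermediate-colouring (h + h) F⊆A (evensFalse⇒count[2h]≤h h (forcedRed-even j))
                               (≤-trans h≤|padding| (count-mono (h + h) padding⊆A)))
  where
  F A : ℕ → Bool
  F = forcedRed j
  A x = F x ∨ padding qs x
  F⊆A : F ⊆[ h + h ] A
  F⊆A {x} _ _ Fx = Equivalence.from (T-∨ {F x}) (inj₁ Fx)
  padding⊆A : padding qs ⊆[ h + h ] A
  padding⊆A {x} _ _ pad = Equivalence.from (T-∨ {F x}) (inj₂ pad)
  good : ∃[ c ] F ⊆[ h + h ] c × c ⊆[ h + h ] A × count c (h + h) ≡ h → Good (2 + j) (h + h)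
  good (c , F⊆c , c⊆A , count≡h) = c , count≡half⇒balanced h c count≡h , no-coprimeSet
    where
    red⇒witnessed : ∀ {x} → 1 ≤ x × x ≤ h + h × c x ≡ true → WitnessedIn 1 1 j x
    red⇒witnessed {x} (1≤x , x≤2h , cx≡true)
      with Equivalence.to (T-∨ {F x}) (c⊆A 1≤x x≤2h (Equivalence.from T-≡ cx≡true))
    ... | inj₁ Fx  = forcedRed⇒witnessed j 1≤x Fx
    ... | inj₂ pad = padding⇒witnessed j qs-red pad
    blue⇒witnessed : ∀ {x} → 1 ≤ x × x ≤ h + h × c x ≡ false → WitnessedIn 2 (suc j) j x
    blue⇒witnessed {x} (1≤x , x≤2h , cx≡false) =
      blueFactor⇒witnessed j p-prime π[p] 1≤x (subst (x <_) (sym p≡1+2h) (s≤s x≤2h))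
        (¬forcedRed⇒blueFactor j x (λ Fx → subst T cx≡false (F⊆c 1≤x x≤2h Fx)))
    no-coprimeSet : ∀ b → HasCoprimeSet (2 + j) (h + h) c b → ⊥
    no-coprimeSet true  (xs , |xs|≡2+j , xs-red , xs! , xs-coprime) = 1+n≰n (subst (_≤ suc j) |xs|≡2+j
      (window-pigeonhole xs! xs-coprime (All.map red⇒witnessed xs-red)))
    no-coprimeSet false (xs , |xs|≡2+j , xs-blue , xs! , xs-coprime) = 1+n≰n (subst (_≤ suc j) |xs|≡2+j
      (window-pigeonhole xs! xs-coprime (All.map blue⇒witnessed xs-blue)))

-- Density of the padding

anyDivides-shift : ∀ {P x qs} → All (_∣ P) qs → Any (_∣ x) qs ⇔ Any (_∣ x + P) qs
anyDivides-shift {qs = []}     []           = mk⇔ (λ ()) (λ ())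
anyDivides-shift {P} {x} {q ∷ qs} (q∣P ∷ qs∣P) = mk⇔
  (λ { (here q∣x)   → here (∣m∣n⇒∣m+n q∣x q∣P)
     ; (there any) → there (Equivalence.to (anyDivides-shift qs∣P) any) })
  (λ { (here q∣x+P) → here (∣m+n∣m⇒∣n (subst (q ∣_) (+-comm x P) q∣x+P) q∣P)
     ; (there any)  → there (Equivalence.from (anyDivides-shift qs∣P) any) })

multipleOfAny-periodic : ∀ {P qs} → All (_∣ P) qs → ∀ x → multipleOfAny qs (x + P) ≡ multipleOfAny qs x
multipleOfAny-periodic {qs = qs} qs∣P x =
  sym (does-⇔ (anyDivides-shift qs∣P) (any? (_∣? x) qs) (any? (_∣? _) qs))

multipleOf357 : ℕ → Bool
multipleOf357 = multipleOfAny (3 ∷ 5 ∷ 7 ∷ [])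

count-multipleOf357-+210 : ∀ n → count multipleOf357 (n + 210) ≡ count multipleOf357 n + 114
count-multipleOf357-+210 = count-periodic 210
  (multipleOfAny-periodic {qs = 3 ∷ 5 ∷ 7 ∷ []} (divides 70 refl ∷ divides 42 refl ∷ divides 30 refl ∷ []))

density357-table : All (λ h → T (h ≤ᵇ suc (count multipleOf357 (h + h)))) (upTo 105)
density357-table = All.all⁺ (λ h → h ≤ᵇ suc (count multipleOf357 (h + h))) (upTo 105) tt

density357-step : ∀ h → h ≤ suc (count multipleOf357 (h + h)) →
                  105 + h ≤ suc (count multipleOf357 ((105 + h) + (105 + h)))
density357-step h h≤ = begin
  105 + h                                            ≤⟨ +-monoʳ-≤ 105 h≤ ⟩
  105 + suc (count multipleOf357 (h + h))            ≤⟨ +-monoˡ-≤ _ (≤ᵇ⇒≤ 105 114 _) ⟩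
  114 + suc (count multipleOf357 (h + h))            ≡⟨ +-comm 114 _ ⟩
  suc (count multipleOf357 (h + h) + 114)            ≡⟨ cong suc (count-multipleOf357-+210 (h + h)) ⟨
  suc (count multipleOf357 ((h + h) + 210))          ≡⟨ cong (λ m → suc (count multipleOf357 m)) (shift h) ⟩
  suc (count multipleOf357 ((105 + h) + (105 + h)))  ∎
  where
  open ≤-Reasoning
  shift : ∀ h → (h + h) + 210 ≡ (105 + h) + (105 + h)
  shift = solve-∀

-- Every block of 210 consecutive numbers contains 114 ≥ 105 multiples of 3, 5 or 7.
density357 : ∀ h → h ≤ suc (count multipleOf357 (h + h))
density357 = <-rec _ bound
  where
  bound : ∀ h → (∀ {h′} → h′ < h → h′ ≤ suc (count multipleOf357 (h′ + h′))) →
          h ≤ suc (count multipleOf357 (h + h))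
  bound h rec with h <? 105
  ... | yes h<105 = ≤ᵇ⇒≤ h _ (All.lookup density357-table (∈-upTo⁺ h<105))
  ... | no  h≮105 = subst (λ h → h ≤ suc (count multipleOf357 (h + h))) (m+[n∸m]≡n 105≤h)
                          (density357-step (h ∸ 105) (rec (∸-monoʳ-< z<s 105≤h)))
    where
    105≤h : 105 ≤ h
    105≤h = ≮⇒≥ h≮105

count-padding : ∀ qs n → multipleOfAny qs 1 ≡ false →
                count (padding qs) (suc n) ≡ suc (count (multipleOfAny qs) (suc n))
count-padding qs zero    1-unmarked rewrite 1-unmarked = refl
count-padding qs (suc n) 1-unmarked with count-padding qs n 1-unmarked | multipleOfAny qs (suc (suc n))
... | ih | true  = cong suc ih
... | ih | false = ih

padding357-density : ∀ h → h ≤ count (padding (3 ∷ 5 ∷ 7 ∷ [])) (h + h)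
padding357-density zero     = z≤n
padding357-density (suc h′) =
  subst (suc h′ ≤_) (sym (count-padding (3 ∷ 5 ∷ 7 ∷ []) (h′ + suc h′) refl)) (density357 (suc h′))

prime-3 : Prime 3
prime-3 = from-yes (prime? 3)

prime-5 : Prime 5
prime-5 = from-yes (prime? 5)

prime-7 : Prime 7
prime-7 = from-yes (prime? 7)

prime-13 : Prime 13
prime-13 = from-yes (prime? 13)

-- For k = 2, 3, 4 the prime p is 3, 7, 13, and the bound is checked by computation.
sufficient-padding : ∀ j {p} → Prime p → primeCount p ≡ 2 + (j + j) →
                     ∃[ qs ] All (PrimeOfRankIn 1 j) qs × p / 2 ≤ count (padding qs) (p / 2 + p / 2)
sufficient-padding 0 p-prime π[p] with refl ← primeCount-injective p-prime prime-3 π[p] =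
  [] , [] , ≤ᵇ⇒≤ _ _ tt
sufficient-padding 1 p-prime π[p] with refl ← primeCount-injective p-prime prime-7 π[p] =
  3 ∷ [] , (prime-3 , ≤-refl , ≤-refl) ∷ [] , ≤ᵇ⇒≤ _ _ tt
sufficient-padding 2 p-prime π[p] with refl ← primeCount-injective p-prime prime-13 π[p] =
  3 ∷ 5 ∷ [] ,
  (prime-3 , ≤ᵇ⇒≤ _ _ tt , ≤ᵇ⇒≤ _ _ tt) ∷ (prime-5 , ≤ᵇ⇒≤ _ _ tt , ≤ᵇ⇒≤ _ _ tt) ∷ [] ,
  ≤ᵇ⇒≤ _ _ tt
sufficient-padding (suc (suc (suc j))) {p} _ _ =
  3 ∷ 5 ∷ 7 ∷ [] ,
  (prime-3 , ≤ᵇ⇒≤ _ _ tt , ≤ᵇ⇒≤ _ _ tt) ∷ (prime-5 , ≤ᵇ⇒≤ _ _ tt , ≤ᵇ⇒≤ _ _ tt) ∷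
  (prime-7 , ≤ᵇ⇒≤ _ _ tt , ≤ᵇ⇒≤ _ _ tt) ∷ [] ,
  padding357-density (p / 2)

odd-prime : ∀ {p} → Prime p → p ≢ 2 → p ≡ suc (p / 2 + p / 2)
odd-prime {p} p-prime p≢2 = begin
  p                   ≡⟨ m≡m%n+[m/n]*n p 2 ⟩
  p % 2 + p / 2 * 2   ≡⟨ cong₂ _+_ p%2≡1 (*-comm (p / 2) 2) ⟩
  1 + 2 * (p / 2)     ≡⟨ cong (λ m → suc (p / 2 + m)) (+-identityʳ (p / 2)) ⟩
  suc (p / 2 + p / 2) ∎
  where
  open ≡-Reasoning
  p%2≡1 : p % 2 ≡ 1
  p%2≡1 with p % 2 in p%2≡ | m%n<n p 2
  ... | 0           | _ = ⊥-elim ([ (λ ()) , p≢2 ∘ sym ]′ (prime⇒irreducible p-prime (m%n≡0⇒n∣m p 2 p%2≡)))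
  ... | 1           | _ = refl
  ... | suc (suc _) | s≤s (s≤s ())

2*[2+j]∸2≡2+2j : ∀ j → 2 * (2 + j) ∸ 2 ≡ 2 + (j + j)
2*[2+j]∸2≡2+2j j = begin
  j + suc (suc (j + 0))  ≡⟨ +-suc j (suc (j + 0)) ⟩
  suc (j + suc (j + 0))  ≡⟨ cong suc (+-suc j (j + 0)) ⟩
  2 + (j + (j + 0))      ≡⟨ cong (λ m → 2 + (j + m)) (+-identityʳ j) ⟩
  2 + (j + j)            ∎
  where open ≡-Reasoning

[2+j]+[2+j]≡4+2j : ∀ j → (2 + j) + (2 + j) ≡ 4 + (j + j)
[2+j]+[2+j]≡4+2j = solve-∀

theorem6p2 : (k : ℕ) → 2 ≤ k → (p : ℕ) → IsNthPrime (2 * k ∸ 2) p →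
    IsLbal k (p ∸ 1)
theorem6p2 (suc (suc j)) (s≤s (s≤s z≤n)) p (p-prime , π[p]≡2k∸2) = 1≤p∸1 , good , maximal
  where
  π[p] : primeCount p ≡ 2 + (j + j)
  π[p] = trans π[p]≡2k∸2 (2*[2+j]∸2≡2+2j j)
  p≡1+2h : p ≡ suc (p / 2 + p / 2)
  p≡1+2h = odd-prime p-prime (λ p≡2 → 0≢1+n (suc-injective (trans (sym (cong primeCount p≡2)) π[p])))
  p∸1≡2h : p ∸ 1 ≡ p / 2 + p / 2
  p∸1≡2h = cong (_∸ 1) p≡1+2h
  1≤p∸1 : 1 ≤ p ∸ 1
  1≤p∸1 = subst (1 ≤_) (sym p∸1≡2h) (≤-pred (subst (2 ≤_) p≡1+2h (prime⇒≥2 p-prime)))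
  good : Good (2 + j) (p ∸ 1)
  good with qs , qs-red , enough ← sufficient-padding j p-prime π[p] =
    subst (Good (2 + j)) (sym p∸1≡2h) (good-colouring j p-prime π[p] p≡1+2h qs-red enough)
  maximal : ∀ n → 1 ≤ n → Good (2 + j) n → n ≤ p ∸ 1
  maximal n _ (c , _ , no-coprimeSet) with p ≤? n
  ... | yes p≤n = ⊥-elim (uncurry no-coprimeSet (monochromatic-coprimeSet-≥p p-prime
                    (≤-reflexive (trans ([2+j]+[2+j]≡4+2j j) (cong (2 +_) (sym π[p])))) p≤n c))
  ... | no  p≰n = subst (n ≤_) (sym p∸1≡2h) (≤-pred (subst (n <_) p≡1+2h (≰⇒> p≰n)))
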